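{- For integers $k\geq r\geq 2$, $\pi_\lambda(\mathcal{K}_{k+1}^{(r)})\leq\frac{(k)_r}{k^r}$.
   Context: An $r$-graph is an $r$-uniform hypergraph. For an $r$-graph $H$ on $[n]$, $\lambda^{(1)}(H)=\max\{r!\sum_{e\in E(H)}\prod_{v\in e}x_v : \bm{x}\in\mathbb{R}^n,\ \|\bm{x}\|_1=1\}$ (the Lagrangian). For a family $\mathcal{F}$, $\pi_\lambda(\mathcal{F})=\sup\{\lambda^{(1)}(H): H\text{ contains no member of }\mathcal{F}\text{ as a subgraph}\}$. $(k)_r=k(k-1)\cdots(k-r+1)$. For $t\geq r+1$, $\mathcal{K}_t^{(r)}$ is the family of all $r$-graphs $F$ with at most $\binom t2$ edges such that for some $t$-set $C\subseteq V(F)$ every pair of vertices of $C$ is contained in some edge of $F$.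
   Formalization: The vectors x in the Lagrangian $\lambda^{(1)}(H)$ range over rational vectors with ℓ₁-norm 1, taken in ℚ^n rather than ℝ^n. -}

module Defs where

open import Data.Nat as ℕ using (ℕ; zero; suc; _∸_; _!)
open import Data.Nat.Combinatorics using (_C_)
open import Data.Fin using (Fin; zero; suc)
open import Data.Fin.Subset as S using (Subset)
open import Data.Vec using ([]; _∷_)
open import Data.Bool using (true; false)
open import Data.List using (List; length)
open import Data.List.Relation.Unary.All using (All)
open import Data.List.Relation.Unary.Any using (Any)
open import Data.List.Relation.Unary.Unique.Propositional using (Unique)
open import Data.Product using (Σ; ∃; _×_)
open import Data.Integer using (+_)
open import Data.Rational using (ℚ; 0ℚ; 1ℚ; _+_; _*_; _/_)
open import Function.Definitions using (Injective)
open import Relation.Binary.PropositionalEquality using (_≡_; _≢_)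

record RGraph (r n : ℕ) : Set where
  field
    edges   : List (Subset n)
    uniform : All (λ e → S.∣ e ∣ ≡ r) edges
    simple  : Unique edges
open RGraph public

-- F (on Fin m) is a subgraph of H (on Fin n): an injective vertex map sending
-- every edge of F into (hence, by size, onto) an edge of H.
_⊆G_ : ∀ {r m n} → RGraph r m → RGraph r n → Set
_⊆G_ {m = m} {n} F H =
  Σ (Fin m → Fin n) λ f → Injective _≡_ _≡_ f ×
    All (λ e → Any (λ e′ → ∀ j → j S.∈ e → f j S.∈ e′) (edges H)) (edges F)

InK : (t r : ℕ) → ∀ {m} → RGraph r m → Set
InK t r {m} F =
  length (edges F) ℕ.≤ t C 2 ×
  Σ (Subset m) λ C → S.∣ C ∣ ≡ t ×
    (∀ i j → i S.∈ C → j S.∈ C → i ≢ j →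
      Any (λ e → i S.∈ e × j S.∈ e) (edges F))

KFree : (t r : ℕ) → ∀ {n} → RGraph r n → Set
KFree t r {n} H = ∀ m (F : RGraph r m) → InK t r F → F ⊆G H → Data.Empty.⊥
  where import Data.Empty

fromℕ : ℕ → ℚ
fromℕ k = (+ k) / 1

sumF : ∀ {n} → (Fin n → ℚ) → ℚ
sumF {zero}  f = 0ℚ
sumF {suc n} f = f zero + sumF (λ i → f (suc i))

prodS : ∀ {n} → Subset n → (Fin n → ℚ) → ℚ
prodS []          x = 1ℚ
prodS (true ∷ b)  x = x zero * prodS b (λ i → x (suc i))
prodS (false ∷ b) x = prodS b (λ i → x (suc i))

sumL : List ℚ → ℚ
sumL Data.List.[] = 0ℚ
sumL (q Data.List.∷ qs) = q + sumL qs

lagPoly : ∀ {r n} → RGraph r n → (Fin n → ℚ) → ℚ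
lagPoly {r} H x = fromℕ (r !) * sumL (Data.List.map (λ e → prodS e x) (edges H))

fall : ℕ → ℕ → ℕ
fall k zero    = 1
fall k (suc r) = (k ∸ r) ℕ.* fall k r

module Submission where

-- For nonnegative weights y supported on a set S of vertices we show
-- k^r r! Σ_{e ∈ H} Π_{v ∈ e} y_v ≤ (k)_r (Σ_v y_v)^r by induction on |S|.
-- If |S| ≤ k, the edge sum is at most the elementary symmetric polynomial e_r(y), and
-- Maclaurin's inequality for k variables finishes; it is proved by induction on the
-- number of coordinates, the inductive step being the weighted AM–GM inequality.
-- If |S| > k, a 𝒦_{k+1}-free H has two vertices u, v ∈ S lying in no common edge.
-- As no edge contributes a y_u y_v term, the edge sum is affine in (y_u, y_v), so it is the
-- (y_u, y_v)-weighted average of its values after moving all weight of v onto u and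
-- all weight of u onto v; both moves shrink the support and preserve Σ y.
-- Weights of arbitrary sign reduce to their absolute values.

module _ where

  open import Defs
  open import Algebra.Bundles using (CommutativeRing)
  open import Data.Bool as Bool using (Bool; true; false; if_then_else_)
  import Data.Bool.Properties as Bool
  open import Data.Empty using (⊥-elim)
  open import Data.Fin as Fin using (Fin; zero; suc)
  import Data.Fin.Properties as Fin
  open import Data.Fin.Subset as Sub using (Subset; inside; outside; _∈_; _∉_; ∣_∣)
  open import Data.Fin.Subset.Properties
    using (_∈?_; ∉⊥; ∣⊥∣≡0; x∈p∧x≢y⇒x∈p-y; x∈p⇒∣p-x∣<∣p∣; ∣p∣≤n; ∈⊤)
  import Data.Integer as ℤ
  import Data.Integer.Properties as ℤ
  open import Data.List as List using (List; []; _∷_; length; _++_; filter)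
  import Data.List.Properties as List
  open import Data.List.Membership.Propositional using (find; lose) renaming (_∈_ to _∈ₗ_)
  import Data.List.Membership.DecPropositional as DecMembership
  open import Data.List.Membership.Propositional.Properties
    using (∈-map⁺; ∈-map⁻; ∈-++⁺ˡ; ∈-++⁺ʳ; ∈-++⁻; ∈-filter⁺; ∈-filter⁻)
  open import Data.List.Relation.Unary.All as All using (All; []; _∷_)
  open import Data.List.Relation.Unary.All.Properties using (¬Any⇒All¬)
  open import Data.List.Relation.Unary.Any as Any using (Any; here; there)
  open import Data.List.Relation.Unary.AllPairs using ([]; _∷_)
  open import Data.List.Relation.Unary.Unique.Propositional using (Unique)
  open import Data.Nat as ℕ using (ℕ; zero; suc; z≤n; s≤s; _!)
  import Data.Nat.Properties as ℕ
  open import Data.Nat.Combinatorics using (_C_; nC1≡n; nCk+nC[k+1]≡[n+1]C[k+1])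
  import Data.Nat.Coprimality as Coprime
  open import Data.Product using (Σ; _×_; _,_; proj₁; proj₂; swap)
  open import Data.Rational as ℚ
    using (ℚ; mkℚ; 0ℚ; 1ℚ; _+_; _*_; _-_; _≤_; _<_; nonNegative; positive)
  open import Data.Rational.Properties
  import Data.Rational.Unnormalised as ℚᵘ
  import Data.Rational.Unnormalised.Properties as ℚᵘ
  open import Data.Rational.Solver using (module +-*-Solver)
  open import Data.Sum using (_⊎_; inj₁; inj₂)
  open import Data.Vec using (_∷_; []; here; there)
  import Data.Vec.Properties as Vec
  open import Data.Vec.Functional using (tail; updateAt)
  open import Data.Vec.Functional.Properties
    using (updateAt-updates; updateAt-minimal; updateAt-id-local; updateAt-commutes)
  open import Function using (id; _∘_; const)
  open import Relation.Binary.Definitions using (DecidableEquality)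
  open import Relation.Binary.PropositionalEquality
  open import Relation.Nullary using (Dec; yes; no; does; ¬_)
  open import Relation.Nullary.Decidable using (_×-dec_; ¬?; decidable-stable)
  open import Algebra.Properties.CommutativeSemigroup ℕ.*-commutativeSemigroup using (x∙yz≈y∙xz)
  open import Algebra.Properties.CommutativeSemiring.Exp
    (CommutativeRing.commutativeSemiring +-*-commutativeRing) using (_^_; ^-distrib-*)
  open +-*-Solver

  -- Rational arithmetic

  private
    -- fromℕ k = (+ k) / 1 only reduces by normalisation; embed k is its normal form,
    -- on which toℚᵘ computes.
    embed : ℕ → ℚ
    embed k = mkℚ (ℤ.+ k) 0 (Coprime.sym (Coprime.1-coprimeTo k))

    fromℕ≡embed : ∀ k → fromℕ k ≡ embed k
    fromℕ≡embed k = ↥p/↧p≡p (embed k)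

  fromℕ-+ : ∀ m n → fromℕ (m ℕ.+ n) ≡ fromℕ m + fromℕ n
  fromℕ-+ m n rewrite fromℕ≡embed (m ℕ.+ n) | fromℕ≡embed m | fromℕ≡embed n =
    toℚᵘ-injective (ℚᵘ.≃-sym (ℚᵘ.≃-trans (toℚᵘ-homo-+ (embed m) (embed n)) (ℚᵘ.*≡* eq)))
    where
    open import Data.Integer using (+_)
    eq : (+ m ℤ.* + 1 ℤ.+ + n ℤ.* + 1) ℤ.* + 1 ≡ + (m ℕ.+ n) ℤ.* (+ 1 ℤ.* + 1)
    eq rewrite ℤ.*-identityʳ (+ m) | ℤ.*-identityʳ (+ n) | ℤ.*-identityʳ (+ m ℤ.+ + n) =
      sym (ℤ.pos-+ m n)

  fromℕ-* : ∀ m n → fromℕ (m ℕ.* n) ≡ fromℕ m * fromℕ n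
  fromℕ-* m n rewrite fromℕ≡embed (m ℕ.* n) | fromℕ≡embed m | fromℕ≡embed n =
    toℚᵘ-injective (ℚᵘ.≃-sym (ℚᵘ.≃-trans (toℚᵘ-homo-* (embed m) (embed n)) (ℚᵘ.*≡* eq)))
    where
    open import Data.Integer using (+_)
    eq : (+ m ℤ.* + n) ℤ.* + 1 ≡ + (m ℕ.* n) ℤ.* (+ 1 ℤ.* + 1)
    eq rewrite ℤ.*-identityʳ (+ m ℤ.* + n) | ℤ.*-identityʳ (+ (m ℕ.* n)) = sym (ℤ.pos-* m n)

  fromℕ-suc : ∀ n → fromℕ (suc n) ≡ 1ℚ + fromℕ n
  fromℕ-suc = fromℕ-+ 1

  fromℕ-∸ : ∀ {m n} → n ℕ.≤ m → fromℕ (m ℕ.∸ n) ≡ fromℕ m - fromℕ n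
  fromℕ-∸ {m} {n} n≤m = begin
    fromℕ (m ℕ.∸ n)                      ≡⟨ solve 2 (λ d n → d := d :+ n :- n) refl (fromℕ (m ℕ.∸ n)) (fromℕ n) ⟩
    fromℕ (m ℕ.∸ n) + fromℕ n - fromℕ n  ≡⟨ cong (_- fromℕ n) (sym (fromℕ-+ (m ℕ.∸ n) n)) ⟩
    fromℕ (m ℕ.∸ n ℕ.+ n) - fromℕ n      ≡⟨ cong (λ k → fromℕ k - fromℕ n) (ℕ.m∸n+n≡m n≤m) ⟩
    fromℕ m - fromℕ n                    ∎
    where open ≡-Reasoning

  fromℕ-^ : ∀ k r → fromℕ (k ℕ.^ r) ≡ fromℕ k ^ r
  fromℕ-^ k zero    = refl
  fromℕ-^ k (suc r) = trans (fromℕ-* k (k ℕ.^ r)) (cong (fromℕ k *_) (fromℕ-^ k r))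

  fromℕ-nonNeg : ∀ k → 0ℚ ≤ fromℕ k
  fromℕ-nonNeg k = subst (0ℚ ≤_) (sym (fromℕ≡embed k)) (nonNegative⁻¹ (embed k))

  fromℕ-pos : ∀ {k} → 0 ℕ.< k → 0ℚ < fromℕ k
  fromℕ-pos {suc k} _ = subst (0ℚ <_) (sym (fromℕ≡embed (suc k))) (positive⁻¹ (embed (suc k)))

  *-nonNeg : ∀ {p q} → 0ℚ ≤ p → 0ℚ ≤ q → 0ℚ ≤ p * q
  *-nonNeg {p} {q} 0≤p 0≤q =
    nonNegative⁻¹ _ {{nonNeg*nonNeg⇒nonNeg p {{nonNegative 0≤p}} q {{nonNegative 0≤q}}}}

  *-pos : ∀ {p q} → 0ℚ < p → 0ℚ < q → 0ℚ < p * q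
  *-pos {p} {q} 0<p 0<q = positive⁻¹ _ {{pos*pos⇒pos p {{positive 0<p}} q {{positive 0<q}}}}

  +-nonNeg : ∀ {p q} → 0ℚ ≤ p → 0ℚ ≤ q → 0ℚ ≤ p + q
  +-nonNeg = +-mono-≤

  ^-nonNeg : ∀ {p} n → 0ℚ ≤ p → 0ℚ ≤ p ^ n
  ^-nonNeg zero    _   = nonNegative⁻¹ 1ℚ
  ^-nonNeg (suc n) 0≤p = *-nonNeg 0≤p (^-nonNeg n 0≤p)

  ^-pos : ∀ {p} n → 0ℚ < p → 0ℚ < p ^ n
  ^-pos zero    _   = positive⁻¹ 1ℚ
  ^-pos (suc n) 0<p = *-pos 0<p (^-pos n 0<p)

  1^n≡1 : ∀ n → 1ℚ ^ n ≡ 1ℚ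
  1^n≡1 zero    = refl
  1^n≡1 (suc n) = trans (*-identityˡ (1ℚ ^ n)) (1^n≡1 n)

  p*p-nonNeg : ∀ p → 0ℚ ≤ p * p
  p*p-nonNeg p with ≤-total 0ℚ p
  ... | inj₁ 0≤p = *-nonNeg 0≤p 0≤p
  ... | inj₂ p≤0 = subst (0ℚ ≤_) (solve 1 (λ p → (:- p) :* (:- p) := p :* p) refl p)
                     (*-nonNeg (neg-antimono-≤ p≤0) (neg-antimono-≤ p≤0))

  p≤∣p∣ : ∀ p → p ≤ ℚ.∣ p ∣
  p≤∣p∣ p with ≤-total 0ℚ p
  ... | inj₁ 0≤p = ≤-reflexive (sym (0≤p⇒∣p∣≡p 0≤p))
  ... | inj₂ p≤0 = ≤-trans p≤0 (0≤∣p∣ p)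

  p≤p+q : ∀ {p q} → 0ℚ ≤ q → p ≤ p + q
  p≤p+q {p} 0≤q = subst (_≤ p + _) (+-identityʳ p) (+-monoʳ-≤ p 0≤q)

  *-monoˡ-≤-0≤ : ∀ {p q r} → 0ℚ ≤ r → p ≤ q → r * p ≤ r * q
  *-monoˡ-≤-0≤ {r = r} 0≤r = *-monoˡ-≤-nonNeg r {{nonNegative 0≤r}}

  *-cancelˡ-≤-0< : ∀ {p q r} → 0ℚ < r → r * p ≤ r * q → p ≤ q
  *-cancelˡ-≤-0< {r = r} 0<r = *-cancelˡ-≤-pos r {{positive 0<r}}

  weighted-average-≤ : ∀ {a b p p₁ p₂ q} → 0ℚ ≤ a → 0ℚ ≤ b → 0ℚ < a + b →
    (a + b) * p ≡ a * p₁ + b * p₂ → p₁ ≤ q → p₂ ≤ q → p ≤ q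
  weighted-average-≤ {a} {b} {p} {p₁} {p₂} {q} 0≤a 0≤b 0<a+b average p₁≤q p₂≤q =
    *-cancelˡ-≤-0< 0<a+b (begin
      (a + b) * p      ≡⟨ average ⟩
      a * p₁ + b * p₂  ≤⟨ +-mono-≤ (*-monoˡ-≤-0≤ 0≤a p₁≤q) (*-monoˡ-≤-0≤ 0≤b p₂≤q) ⟩
      a * q + b * q    ≡⟨ sym (*-distribʳ-+ q a b) ⟩
      (a + b) * q      ∎)
    where open ≤-Reasoning

  -- (s + 1) X Yˢ ≤ Xˢ⁺¹ + s Yˢ⁺¹, rearranged
  am-gm : ∀ s {X Y} → 0ℚ ≤ X → 0ℚ ≤ Y → Y ^ s * (fromℕ (suc s) * X - fromℕ s * Y) ≤ X ^ suc s
  am-gm zero {X} {Y} _ _ = ≤-reflexive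
    (solve 2 (λ X Y → con 1ℚ :* (con 1ℚ :* X :- con 0ℚ :* Y) := X :* con 1ℚ) refl X Y)
  am-gm (suc s) {X} {Y} 0≤X 0≤Y = begin
    Y ^ suc s * (fromℕ (2 ℕ.+ s) * X - fromℕ (suc s) * Y)
      ≡⟨ cong₂ (λ p q → Y * P * (p * X - q * Y))
           (trans (fromℕ-suc (suc s)) (cong (1ℚ +_) (fromℕ-suc s))) (fromℕ-suc s) ⟩
    Y * P * ((1ℚ + (1ℚ + c)) * X - (1ℚ + c) * Y)
      ≤⟨ p≤p+q (*-nonNeg (*-nonNeg (+-nonNeg (fromℕ-nonNeg 1) (fromℕ-nonNeg s)) (^-nonNeg s 0≤Y))
                         (p*p-nonNeg (X - Y))) ⟩
    Y * P * ((1ℚ + (1ℚ + c)) * X - (1ℚ + c) * Y) + (1ℚ + c) * P * ((X - Y) * (X - Y))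
      ≡⟨ solve 4 (λ X Y P c →
           Y :* P :* ((con 1ℚ :+ (con 1ℚ :+ c)) :* X :- (con 1ℚ :+ c) :* Y)
             :+ (con 1ℚ :+ c) :* P :* ((X :- Y) :* (X :- Y))
           := X :* (P :* ((con 1ℚ :+ c) :* X :- c :* Y))) refl X Y P c ⟩
    X * (P * ((1ℚ + c) * X - c * Y))
      ≡⟨ cong (λ p → X * (P * (p * X - c * Y))) (sym (fromℕ-suc s)) ⟩
    X * (P * (fromℕ (suc s) * X - c * Y))
      ≤⟨ *-monoˡ-≤-0≤ 0≤X (am-gm s 0≤X 0≤Y) ⟩
    X * X ^ suc s ∎
    where
    open ≤-Reasoning
    P = Y ^ s
    c = fromℕ s

  -- Maclaurin's inequality

  fall-suc : ∀ m s → fall (suc m) (suc s) ≡ suc m ℕ.* fall m s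
  fall-suc m zero    = refl
  fall-suc m (suc s) = begin
    (m ℕ.∸ s) ℕ.* fall (suc m) (suc s)  ≡⟨ cong ((m ℕ.∸ s) ℕ.*_) (fall-suc m s) ⟩
    (m ℕ.∸ s) ℕ.* (suc m ℕ.* fall m s)  ≡⟨ x∙yz≈y∙xz (m ℕ.∸ s) (suc m) (fall m s) ⟩
    suc m ℕ.* ((m ℕ.∸ s) ℕ.* fall m s)  ∎
    where open ≡-Reasoning

  private
    step-regroup : ∀ {φ σ f} → φ ≡ σ * f → ∀ M PM K PK a e e′ →
      M * PM * (K * PK * φ * (a * e + e′)) ≡ K * PK * (σ * M * a * (PM * f * e) + M * PM * φ * e′)
    step-regroup {σ = σ} {f} refl M PM K PK a e e′ = solve 9 (λ σ f M PM K PK a e e′ →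
        M :* PM :* (K :* PK :* (σ :* f) :* (a :* e :+ e′))
        := K :* PK :* (σ :* M :* a :* (PM :* f :* e) :+ M :* PM :* (σ :* f) :* e′))
      refl σ f M PM K PK a e e′

    step-factor : ∀ {K M σ c F F′} → K ≡ 1ℚ + M → σ ≡ 1ℚ + c → F′ ≡ (M - c) * F → ∀ a b PK Pb →
      K * PK * (σ * M * a * (F * Pb) + F′ * (b * Pb))
        ≡ K * F * (PK * Pb * (σ * (M * (a + b)) - c * (K * b)))
    step-factor {M = M} {c = c} {F = F} refl refl refl a b PK Pb = solve 7 (λ M c F a b PK Pb →
        (con 1ℚ :+ M) :* PK :* ((con 1ℚ :+ c) :* M :* a :* (F :* Pb) :+ (M :- c) :* F :* (b :* Pb))
        := (con 1ℚ :+ M) :* F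
             :* (PK :* Pb :* ((con 1ℚ :+ c) :* (M :* (a :+ b)) :- c :* ((con 1ℚ :+ M) :* b))))
      refl M c F a b PK Pb

  -- Clearing the factor mˢ⁺¹, the two bounds for the smaller case reduce the claim to
  -- am-gm with X = m (a + b) and Y = (m + 1) b.
  maclaurin-step : ∀ {m s} → s ℕ.≤ m → 0 ℕ.< m → ∀ {a b e e′} → 0ℚ ≤ a → 0ℚ ≤ b →
    fromℕ m ^ s * fromℕ (s !) * e ≤ fromℕ (fall m s) * b ^ s →
    fromℕ m ^ suc s * fromℕ (suc s !) * e′ ≤ fromℕ (fall m (suc s)) * b ^ suc s →
    fromℕ (suc m) ^ suc s * fromℕ (suc s !) * (a * e + e′) ≤ fromℕ (fall (suc m) (suc s)) * (a + b) ^ suc s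
  maclaurin-step {m} {s} s≤m 0<m {a} {b} {e} {e′} 0≤a 0≤b ih ih′ =
    *-cancelˡ-≤-0< (^-pos (suc s) (fromℕ-pos 0<m)) (begin
      M ^ suc s * (K ^ suc s * φ * (a * e + e′))
        ≡⟨ step-regroup {φ} {σ} {f} (fromℕ-* (suc s) (s !)) M (M ^ s) K (K ^ s) a e e′ ⟩
      K ^ suc s * (σ * M * a * (M ^ s * f * e) + M ^ suc s * φ * e′)
        ≤⟨ *-monoˡ-≤-0≤ (^-nonNeg (suc s) 0≤K) (+-mono-≤ (*-monoˡ-≤-0≤ 0≤σMa ih) ih′) ⟩
      K ^ suc s * (σ * M * a * (F * b ^ s) + F′ * b ^ suc s)
        ≡⟨ step-factor {K} {M} {σ} {c} {F} {F′} (fromℕ-suc m) (fromℕ-suc s) F′≡[M-c]F a b (K ^ s) (b ^ s) ⟩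
      K * F * (K ^ s * b ^ s * (σ * X - c * Y))
        ≡⟨ cong (λ p → K * F * (p * (σ * X - c * Y))) (sym (^-distrib-* K b s)) ⟩
      K * F * (Y ^ s * (σ * X - c * Y))
        ≤⟨ *-monoˡ-≤-0≤ (*-nonNeg 0≤K (fromℕ-nonNeg (fall m s))) (am-gm s 0≤X (*-nonNeg 0≤K 0≤b)) ⟩
      K * F * (X * X ^ s)
        ≡⟨ cong (λ p → K * F * (X * p)) (^-distrib-* M (a + b) s) ⟩
      K * F * (M * (a + b) * (M ^ s * (a + b) ^ s))
        ≡⟨ solve 6 (λ K F M T PM PT → K :* F :* (M :* T :* (PM :* PT)) := M :* PM :* (K :* F :* (T :* PT)))
             refl K F M (a + b) (M ^ s) ((a + b) ^ s) ⟩
      M ^ suc s * (K * F * (a + b) ^ suc s)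
        ≡⟨ cong (λ p → M ^ suc s * (p * (a + b) ^ suc s)) (sym KF≡fall) ⟩
      M ^ suc s * (fromℕ (fall (suc m) (suc s)) * (a + b) ^ suc s) ∎)
    where
    open ≤-Reasoning
    M = fromℕ m
    K = fromℕ (suc m)
    c = fromℕ s
    σ = fromℕ (suc s)
    f = fromℕ (s !)
    φ = fromℕ (suc s !)
    F = fromℕ (fall m s)
    F′ = fromℕ (fall m (suc s))
    X = M * (a + b)
    Y = K * b
    F′≡[M-c]F : F′ ≡ (M - c) * F
    F′≡[M-c]F = trans (fromℕ-* (m ℕ.∸ s) (fall m s)) (cong (_* F) (fromℕ-∸ s≤m))
    KF≡fall : fromℕ (fall (suc m) (suc s)) ≡ K * F
    KF≡fall = trans (cong fromℕ (fall-suc m s)) (fromℕ-* (suc m) (fall m s))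
    0≤K : 0ℚ ≤ K
    0≤K = fromℕ-nonNeg (suc m)
    0≤X : 0ℚ ≤ X
    0≤X = *-nonNeg (fromℕ-nonNeg m) (+-nonNeg 0≤a 0≤b)
    0≤σMa : 0ℚ ≤ σ * M * a
    0≤σMa = *-nonNeg (*-nonNeg (fromℕ-nonNeg (suc s)) (fromℕ-nonNeg m)) 0≤a

  NonNeg : ∀ {n} → (Fin n → ℚ) → Set
  NonNeg y = ∀ i → 0ℚ ≤ y i

  Supported : ∀ {n} → Subset n → (Fin n → ℚ) → Set
  Supported S y = ∀ i → i ∉ S → y i ≡ 0ℚ

  esym : ∀ {n} → ℕ → (Fin n → ℚ) → ℚ
  esym         zero    y = 1ℚ
  esym {zero}  (suc r) y = 0ℚ
  esym {suc n} (suc r) y = y zero * esym r (tail y) + esym (suc r) (tail y)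

  sumF-nonNeg : ∀ {n} {y : Fin n → ℚ} → NonNeg y → 0ℚ ≤ sumF y
  sumF-nonNeg {zero}  _   = ≤-refl
  sumF-nonNeg {suc n} y≥0 = +-nonNeg (y≥0 zero) (sumF-nonNeg (y≥0 ∘ suc))

  esym-nonNeg : ∀ {n} r {y : Fin n → ℚ} → NonNeg y → 0ℚ ≤ esym r y
  esym-nonNeg         zero    _   = nonNegative⁻¹ 1ℚ
  esym-nonNeg {zero}  (suc r) _   = ≤-refl
  esym-nonNeg {suc n} (suc r) y≥0 =
    +-nonNeg (*-nonNeg (y≥0 zero) (esym-nonNeg r (y≥0 ∘ suc))) (esym-nonNeg (suc r) (y≥0 ∘ suc))

  esym-1 : ∀ {n} (y : Fin n → ℚ) → esym 1 y ≡ sumF y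
  esym-1 {zero}  y = refl
  esym-1 {suc n} y = cong₂ _+_ (*-identityʳ (y zero)) (esym-1 (tail y))

  supported-tail : ∀ {n b} {S : Subset n} {y : Fin (suc n) → ℚ} → Supported (b ∷ S) y → Supported S (tail y)
  supported-tail supp i i∉S = supp (suc i) λ { (there i∈S) → i∉S i∈S }

  esym-vanishes : ∀ {n} r {S : Subset n} {y} → Supported S y → ∣ S ∣ ℕ.< r → esym r y ≡ 0ℚ
  esym-vanishes {zero}  (suc r) _ _ = refl
  esym-vanishes {suc n} (suc r) {outside ∷ S} {y} supp ∣S∣<1+r =
    trans (cong₂ (λ p q → p * esym r (tail y) + q)
            (supp zero λ ()) (esym-vanishes (suc r) (supported-tail supp) ∣S∣<1+r))
          (trans (+-identityʳ _) (*-zeroˡ (esym r (tail y))))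
  esym-vanishes {suc n} (suc r) {inside ∷ S} {y} supp (s≤s ∣S∣<r) =
    trans (cong₂ (λ p q → y zero * p + q)
            (esym-vanishes r (supported-tail supp) ∣S∣<r)
            (esym-vanishes (suc r) (supported-tail supp) (ℕ.m<n⇒m<1+n ∣S∣<r)))
          (trans (+-identityʳ _) (*-zeroʳ (y zero)))

  esym-head-0 : ∀ {n} r {y : Fin (suc n) → ℚ} → y zero ≡ 0ℚ → esym r y ≡ esym r (tail y)
  esym-head-0 zero    _         = refl
  esym-head-0 (suc r) {y} y₀≡0 =
    trans (cong (λ p → p * esym r (tail y) + esym (suc r) (tail y)) y₀≡0)
          (trans (cong (_+ esym (suc r) (tail y)) (*-zeroˡ (esym r (tail y))))
                 (+-identityˡ (esym (suc r) (tail y))))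

  sumF-head-0 : ∀ {n} {y : Fin (suc n) → ℚ} → y zero ≡ 0ℚ → sumF y ≡ sumF (tail y)
  sumF-head-0 {y = y} y₀≡0 = trans (cong (_+ sumF (tail y)) y₀≡0) (+-identityˡ (sumF (tail y)))

  -- e_r / C(k, r) ≤ (e_1 / k)^r for k variables, with denominators cleared
  mutual
    maclaurin : ∀ {n} k r {S : Subset n} {y} → ∣ S ∣ ℕ.≤ k → Supported S y → NonNeg y →
                fromℕ k ^ r * fromℕ (r !) * esym r y ≤ fromℕ (fall k r) * sumF y ^ r
    maclaurin k r {S} {y} ∣S∣≤k supp y≥0 with ∣ S ∣ ℕ.<? r
    ... | no  ∣S∣≮r = maclaurin-≥ k r ∣S∣≤k (ℕ.≮⇒≥ ∣S∣≮r) supp y≥0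
    ... | yes ∣S∣<r = begin
      fromℕ k ^ r * fromℕ (r !) * esym r y  ≡⟨ cong (fromℕ k ^ r * fromℕ (r !) *_) (esym-vanishes r supp ∣S∣<r) ⟩
      fromℕ k ^ r * fromℕ (r !) * 0ℚ        ≡⟨ *-zeroʳ (fromℕ k ^ r * fromℕ (r !)) ⟩
      0ℚ                                    ≤⟨ *-nonNeg (fromℕ-nonNeg (fall k r)) (^-nonNeg r (sumF-nonNeg y≥0)) ⟩
      fromℕ (fall k r) * sumF y ^ r         ∎
      where open ≤-Reasoning

    private
      maclaurin-≥ : ∀ {n} k r {S : Subset n} {y} → ∣ S ∣ ℕ.≤ k → r ℕ.≤ ∣ S ∣ → Supported S y → NonNeg y →
                    fromℕ k ^ r * fromℕ (r !) * esym r y ≤ fromℕ (fall k r) * sumF y ^ r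
      maclaurin-≥ k zero _ _ _ _ = ≤-refl
      maclaurin-≥ k 1 {y = y} _ _ _ _ = ≤-reflexive (begin
        fromℕ k * 1ℚ * 1ℚ * esym 1 y     ≡⟨ cong (fromℕ k * 1ℚ * 1ℚ *_) (esym-1 y) ⟩
        fromℕ k * 1ℚ * 1ℚ * sumF y       ≡⟨ solve 2 (λ K s → K :* con 1ℚ :* con 1ℚ :* s := K :* (s :* con 1ℚ))
                                                refl (fromℕ k) (sumF y) ⟩
        fromℕ k * (sumF y * 1ℚ)          ≡⟨ cong (λ j → fromℕ j * (sumF y * 1ℚ)) (sym (ℕ.*-identityʳ k)) ⟩
        fromℕ (k ℕ.* 1) * (sumF y * 1ℚ)  ∎)
        where open ≡-Reasoning
      maclaurin-≥ k (suc (suc s)) {outside ∷ S} {y} ∣S∣≤k _ supp y≥0 =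
        subst₂ (λ p q → fromℕ k ^ suc (suc s) * fromℕ (suc (suc s) !) * p
                          ≤ fromℕ (fall k (suc (suc s))) * q ^ suc (suc s))
          (sym (esym-head-0 (suc (suc s)) {y} y₀≡0)) (sym (sumF-head-0 {y = y} y₀≡0))
          (maclaurin k (suc (suc s)) {y = tail y} ∣S∣≤k (supported-tail supp) (y≥0 ∘ suc))
        where y₀≡0 = supp zero λ ()
      maclaurin-≥ (suc m) (suc (suc s)) {inside ∷ S} {y} (s≤s ∣S∣≤m) (s≤s 1+s≤∣S∣) supp y≥0 =
        maclaurin-step 1+s≤m (ℕ.<-≤-trans ℕ.z<s 1+s≤m) (y≥0 zero) (sumF-nonNeg (y≥0 ∘ suc))
          (maclaurin m (suc s) {y = tail y} ∣S∣≤m (supported-tail supp) (y≥0 ∘ suc))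
          (maclaurin m (suc (suc s)) {y = tail y} ∣S∣≤m (supported-tail supp) (y≥0 ∘ suc))
        where 1+s≤m = ℕ.≤-trans 1+s≤∣S∣ ∣S∣≤m

  -- Edge polynomials

  edgePoly : ∀ {n} → List (Subset n) → (Fin n → ℚ) → ℚ
  edgePoly L y = sumL (List.map (λ e → prodS e y) L)

  tailsWithHead : ∀ {n} → Bool → List (Subset (suc n)) → List (Subset n)
  tailsWithHead b []            = []
  tailsWithHead b ((c ∷ e) ∷ L) =
    if does (c Bool.≟ b) then e ∷ tailsWithHead b L else tailsWithHead b L

  All-tailsWithHead : ∀ {n} {P : Subset (suc n) → Set} b {L} → All P L → All (P ∘ (b ∷_)) (tailsWithHead b L)
  All-tailsWithHead b []                         = []
  All-tailsWithHead b {(c ∷ e) ∷ L} (pe ∷ pL) with c Bool.≟ b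
  ... | yes refl = pe ∷ All-tailsWithHead b pL
  ... | no  _    = All-tailsWithHead b pL

  Unique-tailsWithHead : ∀ {n} b {L : List (Subset (suc n))} → Unique L → Unique (tailsWithHead b L)
  Unique-tailsWithHead b []                         = []
  Unique-tailsWithHead b {(c ∷ e) ∷ L} (e∉L ∷ uL) with c Bool.≟ b
  ... | yes refl = All.map (λ ne eq → ne (cong (b ∷_) eq)) (All-tailsWithHead b e∉L) ∷ Unique-tailsWithHead b uL
  ... | no  _    = Unique-tailsWithHead b uL

  edgePoly-split : ∀ {n} (L : List (Subset (suc n))) y →
    edgePoly L y ≡ y zero * edgePoly (tailsWithHead true L) (tail y) + edgePoly (tailsWithHead false L) (tail y)
  edgePoly-split [] y = solve 1 (λ a → con 0ℚ := a :* con 0ℚ :+ con 0ℚ) refl (y zero)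
  edgePoly-split ((true ∷ e) ∷ L) y rewrite edgePoly-split L y =
    solve 4 (λ a p A B → a :* p :+ (a :* A :+ B) := a :* (p :+ A) :+ B) refl (y zero) (prodS e (tail y))
      (edgePoly (tailsWithHead true L) (tail y)) (edgePoly (tailsWithHead false L) (tail y))
  edgePoly-split ((false ∷ e) ∷ L) y rewrite edgePoly-split L y =
    solve 4 (λ a p A B → p :+ (a :* A :+ B) := a :* A :+ (p :+ B)) refl (y zero) (prodS e (tail y))
      (edgePoly (tailsWithHead true L) (tail y)) (edgePoly (tailsWithHead false L) (tail y))

  edgePoly≤esym : ∀ {n} r (L : List (Subset n)) {y} → All (λ e → ∣ e ∣ ≡ r) L → Unique L → NonNeg y →
                  edgePoly L y ≤ esym r y
  edgePoly≤esym r [] _ _ y≥0 = esym-nonNeg r y≥0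
  edgePoly≤esym {zero} r ([] ∷ []) (refl ∷ []) _ _ = ≤-refl
  edgePoly≤esym {zero} r ([] ∷ [] ∷ L) _ ((≢[] ∷ _) ∷ _) _ = ⊥-elim (≢[] refl)
  -- here tailsWithHead true L is empty, as its members would have size −1
  edgePoly≤esym {suc n} zero L@(_ ∷ _) {y} sizes uL y≥0
    rewrite edgePoly-split L y
    with tailsWithHead true L | All-tailsWithHead true sizes
  ... | [] | [] = subst (_≤ 1ℚ) (sym (trans (cong (_+ B) (*-zeroʳ (y zero))) (+-identityˡ B)))
                    (edgePoly≤esym zero (tailsWithHead false L) (All-tailsWithHead false sizes)
                       (Unique-tailsWithHead false uL) (y≥0 ∘ suc))
    where B = edgePoly (tailsWithHead false L) (tail y)
  edgePoly≤esym {suc n} (suc r) L@(_ ∷ _) {y} sizes uL y≥0 rewrite edgePoly-split L y =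
    +-mono-≤
      (*-monoˡ-≤-0≤ (y≥0 zero)
        (edgePoly≤esym r (tailsWithHead true L) (All.map ℕ.suc-injective (All-tailsWithHead true sizes))
           (Unique-tailsWithHead true uL) (y≥0 ∘ suc)))
      (edgePoly≤esym (suc r) (tailsWithHead false L) (All-tailsWithHead false sizes)
         (Unique-tailsWithHead false uL) (y≥0 ∘ suc))

  prodS-∣∣ : ∀ {n} (e : Subset n) (x : Fin n → ℚ) → ℚ.∣ prodS e x ∣ ≡ prodS e (λ i → ℚ.∣ x i ∣)
  prodS-∣∣ []          x = refl
  prodS-∣∣ (true ∷ e)  x = trans (∣p*q∣≡∣p∣*∣q∣ (x zero) _) (cong (ℚ.∣ x zero ∣ *_) (prodS-∣∣ e (tail x)))
  prodS-∣∣ (false ∷ e) x = prodS-∣∣ e (tail x)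

  edgePoly-≤-∣∣ : ∀ {n} (L : List (Subset n)) (x : Fin n → ℚ) → edgePoly L x ≤ edgePoly L (λ i → ℚ.∣ x i ∣)
  edgePoly-≤-∣∣ []      x = ≤-refl
  edgePoly-≤-∣∣ (e ∷ L) x =
    +-mono-≤ (≤-trans (p≤∣p∣ (prodS e x)) (≤-reflexive (prodS-∣∣ e x))) (edgePoly-≤-∣∣ L x)

  lagPoly-≤-∣∣ : ∀ {r n} (H : RGraph r n) (x : Fin n → ℚ) → lagPoly H x ≤ lagPoly H (λ i → ℚ.∣ x i ∣)
  lagPoly-≤-∣∣ {r} H x = *-monoˡ-≤-0≤ (fromℕ-nonNeg (r !)) (edgePoly-≤-∣∣ (edges H) x)

  -- Moving weight between two vertices

  infixl 6 _[_]≔_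
  _[_]≔_ : ∀ {n} → (Fin n → ℚ) → Fin n → ℚ → Fin n → ℚ
  y [ i ]≔ c = updateAt y i (const c)

  moveWeight : ∀ {n} (y : Fin n → ℚ) (from to : Fin n) → Fin n → ℚ
  moveWeight y from to = y [ to ]≔ (y to + y from) [ from ]≔ 0ℚ

  prodS-cong : ∀ {n} (e : Subset n) {y z : Fin n → ℚ} → (∀ i → i ∈ e → y i ≡ z i) → prodS e y ≡ prodS e z
  prodS-cong []          _   = refl
  prodS-cong (true ∷ e)  y≡z = cong₂ _*_ (y≡z zero here) (prodS-cong e (λ i → y≡z (suc i) ∘ there))
  prodS-cong (false ∷ e) y≡z = prodS-cong e (λ i → y≡z (suc i) ∘ there)

  prodS-[]≔-∉ : ∀ {n} (e : Subset n) {y i c} → i ∉ e → prodS e (y [ i ]≔ c) ≡ prodS e y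
  prodS-[]≔-∉ e {y} {i} i∉e = prodS-cong e λ j j∈e → updateAt-minimal j i y λ { refl → i∉e j∈e }

  prodS-[]≔-∈ : ∀ {n} (e : Subset n) {y i c} → i ∈ e → prodS e (y [ i ]≔ c) ≡ c * prodS e (y [ i ]≔ 1ℚ)
  prodS-[]≔-∈ (true ∷ e)  {y} {zero}  {c} here = cong (c *_) (sym (*-identityˡ (prodS e (tail y))))
  prodS-[]≔-∈ (true ∷ e)  {y} {suc i} {c} (there i∈e) =
    trans (cong (y zero *_) (prodS-[]≔-∈ e i∈e))
          (solve 3 (λ a c p → a :* (c :* p) := c :* (a :* p)) refl (y zero) c _)
  prodS-[]≔-∈ (false ∷ e) {y} {suc i} (there i∈e) = prodS-[]≔-∈ e i∈e

  Affine : (ℚ → ℚ → ℚ) → Set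
  Affine f = Σ ℚ λ α → Σ ℚ λ β → Σ ℚ λ γ → ∀ c d → f c d ≡ α * c + β * d + γ

  affine-+ : ∀ {f g} → Affine f → Affine g → Affine (λ c d → f c d + g c d)
  affine-+ (α , β , γ , f≡) (α′ , β′ , γ′ , g≡) = α + α′ , β + β′ , γ + γ′ , λ c d →
    trans (cong₂ _+_ (f≡ c d) (g≡ c d))
      (solve 8 (λ α β γ α′ β′ γ′ c d → α :* c :+ β :* d :+ γ :+ (α′ :* c :+ β′ :* d :+ γ′)
                                       := (α :+ α′) :* c :+ (β :+ β′) :* d :+ (γ :+ γ′))
         refl α β γ α′ β′ γ′ c d)

  affine-shift : ∀ {f} → Affine f → ∀ a b → (a + b) * f a b ≡ a * f (a + b) 0ℚ + b * f 0ℚ (b + a)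
  affine-shift {f} (α , β , γ , f≡) a b = begin
    (a + b) * f a b
      ≡⟨ cong ((a + b) *_) (f≡ a b) ⟩
    (a + b) * (α * a + β * b + γ)
      ≡⟨ solve 5 (λ α β γ a b →
           (a :+ b) :* (α :* a :+ β :* b :+ γ)
           := a :* (α :* (a :+ b) :+ β :* con 0ℚ :+ γ) :+ b :* (α :* con 0ℚ :+ β :* (b :+ a) :+ γ))
           refl α β γ a b ⟩
    a * (α * (a + b) + β * 0ℚ + γ) + b * (α * 0ℚ + β * (b + a) + γ)
      ≡⟨ sym (cong₂ (λ p q → a * p + b * q) (f≡ (a + b) 0ℚ) (f≡ 0ℚ (b + a))) ⟩
    a * f (a + b) 0ℚ + b * f 0ℚ (b + a) ∎
    where open ≡-Reasoning

  prodS-affine : ∀ {n} (e : Subset n) {y u v} → u ≢ v → ¬ (u ∈ e × v ∈ e) →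
                 Affine (λ c d → prodS e (y [ u ]≔ c [ v ]≔ d))
  prodS-affine e {y} {u} {v} u≢v not-both with u ∈? e | v ∈? e
  ... | yes u∈e | yes v∈e = ⊥-elim (not-both (u∈e , v∈e))
  ... | yes u∈e | no  v∉e = prodS e (y [ u ]≔ 1ℚ) , 0ℚ , 0ℚ , λ c d →
    trans (prodS-[]≔-∉ e v∉e) (trans (prodS-[]≔-∈ e u∈e)
      (solve 3 (λ α c d → c :* α := α :* c :+ con 0ℚ :* d :+ con 0ℚ) refl (prodS e (y [ u ]≔ 1ℚ)) c d))
  ... | no  u∉e | yes v∈e = 0ℚ , prodS e (y [ v ]≔ 1ℚ) , 0ℚ , λ c d →
    trans (prodS-cong e (λ i _ → updateAt-commutes v u (u≢v ∘ sym) y i))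
      (trans (prodS-[]≔-∉ e u∉e) (trans (prodS-[]≔-∈ e v∈e)
        (solve 3 (λ β c d → d :* β := con 0ℚ :* c :+ β :* d :+ con 0ℚ) refl (prodS e (y [ v ]≔ 1ℚ)) c d)))
  ... | no  u∉e | no  v∉e = 0ℚ , 0ℚ , prodS e y , λ c d →
    trans (prodS-[]≔-∉ e v∉e) (trans (prodS-[]≔-∉ e u∉e)
      (solve 3 (λ γ c d → γ := con 0ℚ :* c :+ con 0ℚ :* d :+ γ) refl (prodS e y) c d))

  edgePoly-affine : ∀ {n} (L : List (Subset n)) {y u v} → u ≢ v → All (λ e → ¬ (u ∈ e × v ∈ e)) L →
                    Affine (λ c d → edgePoly L (y [ u ]≔ c [ v ]≔ d))
  edgePoly-affine []      _   []                        = 0ℚ , 0ℚ , 0ℚ , λ c d →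
    solve 2 (λ c d → con 0ℚ := con 0ℚ :* c :+ con 0ℚ :* d :+ con 0ℚ) refl c d
  edgePoly-affine (e ∷ L) u≢v (not-both ∷ not-both-L) =
    affine-+ (prodS-affine e u≢v not-both) (edgePoly-affine L u≢v not-both-L)

  edgePoly-cong : ∀ {n} (L : List (Subset n)) {y z} → (∀ i → y i ≡ z i) → edgePoly L y ≡ edgePoly L z
  edgePoly-cong []      _   = refl
  edgePoly-cong (e ∷ L) y≗z = cong₂ _+_ (prodS-cong e (λ i _ → y≗z i)) (edgePoly-cong L y≗z)

  edgePoly-moveWeight : ∀ {n} (L : List (Subset n)) {y u v} → u ≢ v → All (λ e → ¬ (u ∈ e × v ∈ e)) L →
    (y u + y v) * edgePoly L y ≡ y u * edgePoly L (moveWeight y v u) + y v * edgePoly L (moveWeight y u v)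
  edgePoly-moveWeight L {y} {u} {v} u≢v not-both = begin
    (a + b) * edgePoly L y
      ≡⟨ cong ((a + b) *_) (edgePoly-cong L y≗y[u≔a][v≔b]) ⟩
    (a + b) * f a b
      ≡⟨ affine-shift (edgePoly-affine L u≢v not-both) a b ⟩
    a * f (a + b) 0ℚ + b * f 0ℚ (b + a)
      ≡⟨ cong (λ p → a * f (a + b) 0ℚ + b * p) (edgePoly-cong L (updateAt-commutes v u (u≢v ∘ sym) y)) ⟩
    a * edgePoly L (moveWeight y v u) + b * edgePoly L (moveWeight y u v) ∎
    where
    open ≡-Reasoning
    a = y u
    b = y v
    f = λ c d → edgePoly L (y [ u ]≔ c [ v ]≔ d)
    y≗y[u≔a][v≔b] : ∀ i → y i ≡ (y [ u ]≔ a [ v ]≔ b) i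
    y≗y[u≔a][v≔b] i =
      sym (trans (updateAt-id-local v (y [ u ]≔ a) (sym (updateAt-minimal v u y (u≢v ∘ sym))) i)
                 (updateAt-id-local u y refl i))

  sumF-[]≔ : ∀ {n} (y : Fin n → ℚ) i c → sumF (y [ i ]≔ c) ≡ sumF y + (c - y i)
  sumF-[]≔ y zero    c = solve 3 (λ c s a → c :+ s := a :+ s :+ (c :- a)) refl c (sumF (tail y)) (y zero)
  sumF-[]≔ y (suc i) c = trans (cong (y zero +_) (sumF-[]≔ (tail y) i c)) (sym (+-assoc (y zero) _ _))

  sumF-moveWeight : ∀ {n} (y : Fin n → ℚ) {u v} → u ≢ v → sumF (moveWeight y v u) ≡ sumF y
  sumF-moveWeight y {u} {v} u≢v = begin
    sumF (y [ u ]≔ (a + b) [ v ]≔ 0ℚ)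
      ≡⟨ sumF-[]≔ (y [ u ]≔ (a + b)) v 0ℚ ⟩
    sumF (y [ u ]≔ (a + b)) + (0ℚ - (y [ u ]≔ (a + b)) v)
      ≡⟨ cong₂ (λ p q → p + (0ℚ - q)) (sumF-[]≔ y u (a + b)) (updateAt-minimal v u y (u≢v ∘ sym)) ⟩
    sumF y + ((a + b) - a) + (0ℚ - b)
      ≡⟨ solve 3 (λ s a b → s :+ ((a :+ b) :- a) :+ (con 0ℚ :- b) := s) refl (sumF y) a b ⟩
    sumF y ∎
    where
    open ≡-Reasoning
    a = y u
    b = y v

  []≔-nonNeg : ∀ {n} {y : Fin n → ℚ} {i c} → NonNeg y → 0ℚ ≤ c → NonNeg (y [ i ]≔ c)
  []≔-nonNeg {y = y} {i} y≥0 c≥0 j with j Fin.≟ i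
  ... | yes refl = subst (0ℚ ≤_) (sym (updateAt-updates j y)) c≥0
  ... | no  j≢i  = subst (0ℚ ≤_) (sym (updateAt-minimal j i y j≢i)) (y≥0 j)

  moveWeight-nonNeg : ∀ {n} {y : Fin n → ℚ} {u v} → NonNeg y → NonNeg (moveWeight y v u)
  moveWeight-nonNeg {u = u} {v} y≥0 = []≔-nonNeg ([]≔-nonNeg y≥0 (+-nonNeg (y≥0 u) (y≥0 v))) ≤-refl

  supported-[]≔ : ∀ {n} {S : Subset n} {y i c} → Supported S y → i ∈ S → Supported S (y [ i ]≔ c)
  supported-[]≔ {y = y} {i} supp i∈S j j∉S = trans (updateAt-minimal j i y λ { refl → j∉S i∈S }) (supp j j∉S)

  supported-[]≔0 : ∀ {n} {S : Subset n} {y i} → Supported S y → Supported (S Sub.- i) (y [ i ]≔ 0ℚ)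
  supported-[]≔0 {y = y} {i} supp j j∉S-i with j Fin.≟ i
  ... | yes refl = updateAt-updates j y
  ... | no  j≢i  = trans (updateAt-minimal j i y j≢i) (supp j λ j∈S → j∉S-i (x∈p∧x≢y⇒x∈p-y j∈S j≢i))

  supported-remove : ∀ {n} {S : Subset n} {y i} → Supported S y → y i ≡ 0ℚ → Supported (S Sub.- i) y
  supported-remove {y = y} {i} supp yᵢ≡0 j j∉S-i =
    trans (sym (updateAt-id-local i y (sym yᵢ≡0) j)) (supported-[]≔0 supp j j∉S-i)

  moveWeight-supported : ∀ {n} {S : Subset n} {y u v} → Supported S y → u ∈ S →
                         Supported (S Sub.- v) (moveWeight y v u)
  moveWeight-supported supp u∈S = supported-[]≔0 (supported-[]≔ supp u∈S)

  x∈p∧∣p∣≤1+n⇒∣p-x∣≤n : ∀ {n N} {S : Subset n} {i} → i ∈ S → ∣ S ∣ ℕ.≤ suc N → ∣ S Sub.- i ∣ ℕ.≤ N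
  x∈p∧∣p∣≤1+n⇒∣p-x∣≤n i∈S ∣S∣≤1+N = ℕ.≤-pred (ℕ.≤-trans (x∈p⇒∣p-x∣<∣p∣ i∈S) ∣S∣≤1+N)

  -- Uncovered pairs in 𝒦_{k+1}-free graphs

  subset-of-size : ∀ {n} t (S : Subset n) → t ℕ.≤ ∣ S ∣ → Σ (Subset n) λ T → ∣ T ∣ ≡ t × T Sub.⊆ S
  subset-of-size {n} zero    S             _           = Sub.⊥ , ∣⊥∣≡0 n , λ x∈⊥ → ⊥-elim (∉⊥ x∈⊥)
  subset-of-size     (suc t) (inside ∷ S)  (s≤s t≤∣S∣) with subset-of-size t S t≤∣S∣
  ... | T , ∣T∣≡t , T⊆S = inside ∷ T , cong suc ∣T∣≡t , λ { here → here ; (there x∈T) → there (T⊆S x∈T) }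
  subset-of-size     (suc t) (outside ∷ S) t<∣S∣       with subset-of-size (suc t) S t<∣S∣
  ... | T , ∣T∣≡t , T⊆S = outside ∷ T , ∣T∣≡t , λ { (there x∈T) → there (T⊆S x∈T) }

  elements : ∀ {n} → Subset n → List (Fin n)
  elements []          = []
  elements (true ∷ p)  = zero ∷ List.map suc (elements p)
  elements (false ∷ p) = List.map suc (elements p)

  length-elements : ∀ {n} (p : Subset n) → length (elements p) ≡ ∣ p ∣
  length-elements []          = refl
  length-elements (true ∷ p)  = cong suc (trans (List.length-map suc (elements p)) (length-elements p))
  length-elements (false ∷ p) = trans (List.length-map suc (elements p)) (length-elements p)

  ∈-elements⁺ : ∀ {n} {p : Subset n} {x} → x ∈ p → x ∈ₗ elements p
  ∈-elements⁺ {p = true ∷ p}  here        = here refl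
  ∈-elements⁺ {p = true ∷ p}  (there x∈p) = there (∈-map⁺ suc (∈-elements⁺ x∈p))
  ∈-elements⁺ {p = false ∷ p} (there x∈p) = ∈-map⁺ suc (∈-elements⁺ x∈p)

  ∈-elements⁻ : ∀ {n} (p : Subset n) {x} → x ∈ₗ elements p → x ∈ p
  ∈-elements⁻ (true ∷ p) (here refl) = here
  ∈-elements⁻ (true ∷ p) (there x∈) with ∈-map⁻ suc x∈
  ... | _ , x∈p , refl = there (∈-elements⁻ p x∈p)
  ∈-elements⁻ (false ∷ p) x∈ with ∈-map⁻ suc x∈
  ... | _ , x∈p , refl = there (∈-elements⁻ p x∈p)

  pairs : ∀ {A : Set} → List A → List (A × A)
  pairs []       = []
  pairs (x ∷ xs) = List.map (x ,_) xs ++ pairs xs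

  length-pairs : ∀ {A : Set} (xs : List A) → length (pairs xs) ≡ length xs C 2
  length-pairs []       = refl
  length-pairs (x ∷ xs) = begin
    length (List.map (x ,_) xs ++ pairs xs)            ≡⟨ List.length-++ (List.map (x ,_) xs) ⟩
    length (List.map (x ,_) xs) ℕ.+ length (pairs xs)  ≡⟨ cong₂ ℕ._+_ ∣x×xs∣≡∣xs∣C1 (length-pairs xs) ⟩
    length xs C 1 ℕ.+ length xs C 2                    ≡⟨ nCk+nC[k+1]≡[n+1]C[k+1] (length xs) 1 ⟩
    suc (length xs) C 2                                ∎
    where
    open ≡-Reasoning
    ∣x×xs∣≡∣xs∣C1 = trans (List.length-map (x ,_) xs) (sym (nC1≡n (length xs)))

  ∈-pairs⁺ : ∀ {A : Set} (xs : List A) {x y} → x ∈ₗ xs → y ∈ₗ xs → x ≢ y →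
             (x , y) ∈ₗ pairs xs ⊎ (y , x) ∈ₗ pairs xs
  ∈-pairs⁺ (z ∷ zs) (here refl) (here refl) x≢y = ⊥-elim (x≢y refl)
  ∈-pairs⁺ (z ∷ zs) (here refl) (there y∈)  _   = inj₁ (∈-++⁺ˡ (∈-map⁺ (z ,_) y∈))
  ∈-pairs⁺ (z ∷ zs) (there x∈)  (here refl) _   = inj₂ (∈-++⁺ˡ (∈-map⁺ (z ,_) x∈))
  ∈-pairs⁺ (z ∷ zs) (there x∈)  (there y∈)  x≢y with ∈-pairs⁺ zs x∈ y∈ x≢y
  ... | inj₁ xy∈ = inj₁ (∈-++⁺ʳ (List.map (z ,_) zs) xy∈)
  ... | inj₂ yx∈ = inj₂ (∈-++⁺ʳ (List.map (z ,_) zs) yx∈)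

  ∈-pairs⁻ : ∀ {A : Set} (xs : List A) {x y} → (x , y) ∈ₗ pairs xs → x ∈ₗ xs × y ∈ₗ xs
  ∈-pairs⁻ (z ∷ zs) xy∈ with ∈-++⁻ (List.map (z ,_) zs) xy∈
  ... | inj₁ xy∈ʰ with ∈-map⁻ (z ,_) xy∈ʰ
  ...   | _ , y∈ , refl = here refl , there y∈
  ∈-pairs⁻ (z ∷ zs) xy∈ | inj₂ xy∈ᵗ with ∈-pairs⁻ zs xy∈ᵗ
  ... | x∈ , y∈ = there x∈ , there y∈

  select-witnesses : ∀ {A B : Set} {R : A → B → Set} → DecidableEquality B →
    ∀ (Es : List B) (P : List A) → All (λ p → Any (R p) Es) P →
    Σ (List B) λ Fs → Unique Fs × All (_∈ₗ Es) Fs × length Fs ℕ.≤ length P × All (λ p → Any (R p) Fs) P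
  select-witnesses _≟_ Es []      []       = [] , [] , [] , z≤n , []
  select-witnesses _≟_ Es (p ∷ P) (w ∷ ws) with select-witnesses _≟_ Es P ws | find w
  ... | Fs , Fs! , Fs⊆Es , ∣Fs∣≤∣P∣ , covFs | e , e∈Es , Rpe with DecMembership._∈?_ _≟_ e Fs
  ...   | yes e∈Fs = Fs , Fs! , Fs⊆Es , ℕ.m≤n⇒m≤1+n ∣Fs∣≤∣P∣ , lose e∈Fs Rpe ∷ covFs
  ...   | no  e∉Fs = e ∷ Fs , ¬Any⇒All¬ Fs e∉Fs ∷ Fs! , e∈Es ∷ Fs⊆Es , s≤s ∣Fs∣≤∣P∣ ,
                     here Rpe ∷ All.map there covFs

  Covered : ∀ {r n} → RGraph r n → Fin n → Fin n → Set
  Covered H u v = Any (λ e → u ∈ e × v ∈ e) (edges H)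

  covered? : ∀ {r n} (H : RGraph r n) u v → Dec (Covered H u v)
  covered? H u v = Any.any? (λ e → u ∈? e ×-dec v ∈? e) (edges H)

  pair-cover⇒K-subgraph : ∀ {t r n} (H : RGraph r n) (T : Subset n) → ∣ T ∣ ≡ t →
    (Fs : List (Subset n)) → Unique Fs → All (_∈ₗ edges H) Fs → length Fs ℕ.≤ t C 2 →
    (∀ i j → i ∈ T → j ∈ T → i ≢ j → Any (λ e → i ∈ e × j ∈ e) Fs) →
    Σ (RGraph r n) λ F → InK t r F × F ⊆G H
  pair-cover⇒K-subgraph H T ∣T∣≡t Fs Fs! Fs⊆E ∣Fs∣≤tC2 covers =
    F , (∣Fs∣≤tC2 , T , ∣T∣≡t , covers) , id , id ,
    All.map (Any.map λ e≡e′ j j∈e → subst (j ∈_) e≡e′ j∈e) Fs⊆E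
    where
    F = record { edges = Fs ; uniform = All.map (All.lookup (uniform H)) Fs⊆E ; simple = Fs! }

  covered-set⇒K-subgraph : ∀ {t r n} (H : RGraph r n) (T : Subset n) → ∣ T ∣ ≡ t →
    (∀ {u v} → u ∈ T → v ∈ T → u ≢ v → Covered H u v) →
    Σ (RGraph r n) λ F → InK t r F × F ⊆G H
  covered-set⇒K-subgraph {t} {r} {n} H T ∣T∣≡t covered =
    let Fs , Fs! , Fs⊆E , ∣Fs∣≤∣P∣ , coverage = select-witnesses (Vec.≡-dec Bool._≟_) (edges H) P witnesses
    in pair-cover⇒K-subgraph H T ∣T∣≡t Fs Fs! Fs⊆E (ℕ.≤-trans ∣Fs∣≤∣P∣ ∣P∣≤tC2) (covers coverage)
    where
    distinct? = λ (p : Fin n × Fin n) → ¬? (proj₁ p Fin.≟ proj₂ p)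
    P = filter distinct? (pairs (elements T))
    witnesses : All (λ p → Covered H (proj₁ p) (proj₂ p)) P
    witnesses = All.tabulate λ {(u , v)} uv∈P →
      let uv∈pairs , u≢v = ∈-filter⁻ distinct? {xs = pairs (elements T)} uv∈P
          u∈ , v∈ = ∈-pairs⁻ (elements T) uv∈pairs
      in covered (∈-elements⁻ T u∈) (∈-elements⁻ T v∈) u≢v
    ∣P∣≤tC2 : length P ℕ.≤ t C 2
    ∣P∣≤tC2 = ℕ.≤-trans (List.length-filter distinct? (pairs (elements T)))
      (ℕ.≤-reflexive (trans (length-pairs (elements T)) (cong (_C 2) (trans (length-elements T) ∣T∣≡t))))
    covers : ∀ {Fs} → All (λ p → Any (λ e → proj₁ p ∈ e × proj₂ p ∈ e) Fs) P →
             ∀ i j → i ∈ T → j ∈ T → i ≢ j → Any (λ e → i ∈ e × j ∈ e) Fs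
    covers coverage i j i∈T j∈T i≢j with ∈-pairs⁺ (elements T) (∈-elements⁺ i∈T) (∈-elements⁺ j∈T) i≢j
    ... | inj₁ ij∈ = All.lookup coverage (∈-filter⁺ distinct? ij∈ i≢j)
    ... | inj₂ ji∈ = Any.map swap (All.lookup coverage (∈-filter⁺ distinct? ji∈ (i≢j ∘ sym)))

  uncovered-pair : ∀ {t r n} (H : RGraph r n) → KFree t r H → (S : Subset n) → t ℕ.≤ ∣ S ∣ →
    Σ (Fin n) λ u → Σ (Fin n) λ v → u ∈ S × v ∈ S × u ≢ v × ¬ Covered H u v
  uncovered-pair {t} {r} {n} H free S t≤∣S∣
    with Fin.any? (λ u → Fin.any? λ v → u ∈? S ×-dec v ∈? S ×-dec ¬? (u Fin.≟ v) ×-dec ¬? (covered? H u v))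
  ... | yes (u , v , uncovered) = u , v , uncovered
  ... | no  none =
    let T , ∣T∣≡t , T⊆S = subset-of-size t S t≤∣S∣
        F , F∈K , F⊆H = covered-set⇒K-subgraph H T ∣T∣≡t λ {u} {v} u∈T v∈T u≢v →
          decidable-stable (covered? H u v) λ ¬cov → none (u , v , T⊆S u∈T , T⊆S v∈T , u≢v , ¬cov)
    in ⊥-elim (free n F F∈K F⊆H)

  -- The bound on the Lagrangian

  module _ (k : ℕ) {r n} (H : RGraph r n) (free : KFree (suc k) r H) where

    private
      Φ : (Fin n → ℚ) → ℚ
      Φ y = fromℕ k ^ r * fromℕ (r !) * edgePoly (edges H) y

      Ψ : ℚ → ℚ
      Ψ s = fromℕ (fall k r) * s ^ r

      Φ≤Ψ-small-support : ∀ {S : Subset n} {y} → ∣ S ∣ ℕ.≤ k → Supported S y → NonNeg y → Φ y ≤ Ψ (sumF y)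
      Φ≤Ψ-small-support ∣S∣≤k supp y≥0 =
        ≤-trans (*-monoˡ-≤-0≤ (*-nonNeg (^-nonNeg r (fromℕ-nonNeg k)) (fromℕ-nonNeg (r !)))
                  (edgePoly≤esym r (edges H) (uniform H) (simple H) y≥0))
                (maclaurin k r ∣S∣≤k supp y≥0)

      Φ-moveWeight : ∀ y {u v} → u ≢ v → All (λ e → ¬ (u ∈ e × v ∈ e)) (edges H) →
        (y u + y v) * Φ y ≡ y u * Φ (moveWeight y v u) + y v * Φ (moveWeight y u v)
      Φ-moveWeight y {u} {v} u≢v not-both = begin
        (a + b) * (c * E y)
          ≡⟨ solve 4 (λ a b c p → (a :+ b) :* (c :* p) := c :* ((a :+ b) :* p)) refl a b c (E y) ⟩
        c * ((a + b) * E y)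
          ≡⟨ cong (c *_) (edgePoly-moveWeight (edges H) {y} u≢v not-both) ⟩
        c * (a * E (moveWeight y v u) + b * E (moveWeight y u v))
          ≡⟨ solve 5 (λ a b c p q → c :* (a :* p :+ b :* q) := a :* (c :* p) :+ b :* (c :* q)) refl a b c _ _ ⟩
        a * (c * E (moveWeight y v u)) + b * (c * E (moveWeight y u v)) ∎
        where
        open ≡-Reasoning
        a = y u
        b = y v
        c = fromℕ k ^ r * fromℕ (r !)
        E = edgePoly (edges H)

      Φ≤Ψ : ∀ N {S : Subset n} {y} → ∣ S ∣ ℕ.≤ N → Supported S y → NonNeg y → Φ y ≤ Ψ (sumF y)
      Φ≤Ψ zero ∣S∣≤0 = Φ≤Ψ-small-support (ℕ.≤-trans ∣S∣≤0 z≤n)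
      Φ≤Ψ (suc N) {S} {y} ∣S∣≤1+N supp y≥0 with ∣ S ∣ ℕ.≤? k
      ... | yes ∣S∣≤k = Φ≤Ψ-small-support ∣S∣≤k supp y≥0
      ... | no  ∣S∣≰k with uncovered-pair H free S (ℕ.≰⇒> ∣S∣≰k)
      ...   | u , v , u∈S , v∈S , u≢v , uncovered with y v ≤? 0ℚ
      ...     | yes yᵥ≤0 =
        Φ≤Ψ N (x∈p∧∣p∣≤1+n⇒∣p-x∣≤n v∈S ∣S∣≤1+N) (supported-remove supp (≤-antisym yᵥ≤0 (y≥0 v))) y≥0
      ...     | no  yᵥ≰0 =
        weighted-average-≤ (y≥0 u) (y≥0 v) 0<yᵤ+yᵥ (Φ-moveWeight y u≢v (¬Any⇒All¬ (edges H) uncovered))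
          (moved u≢v u∈S v∈S) (moved (u≢v ∘ sym) v∈S u∈S)
        where
        0<yᵤ+yᵥ : 0ℚ < y u + y v
        0<yᵤ+yᵥ = subst (_< y u + y v) (+-identityˡ 0ℚ) (+-mono-≤-< (y≥0 u) (≰⇒> yᵥ≰0))
        moved : ∀ {a b} → a ≢ b → a ∈ S → b ∈ S → Φ (moveWeight y b a) ≤ Ψ (sumF y)
        moved a≢b a∈S b∈S = subst (λ s → Φ (moveWeight y _ _) ≤ Ψ s) (sumF-moveWeight y a≢b)
          (Φ≤Ψ N (x∈p∧∣p∣≤1+n⇒∣p-x∣≤n b∈S ∣S∣≤1+N) (moveWeight-supported supp a∈S) (moveWeight-nonNeg y≥0))

    lagrangian-bound : ∀ {y} → NonNeg y → sumF y ≡ 1ℚ → fromℕ (k ℕ.^ r) * lagPoly H y ≤ fromℕ (fall k r)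
    lagrangian-bound {y} y≥0 ∑y≡1 = begin
      fromℕ (k ℕ.^ r) * (fromℕ (r !) * edgePoly (edges H) y)  ≡⟨ cong (_* _) (fromℕ-^ k r) ⟩
      fromℕ k ^ r * (fromℕ (r !) * edgePoly (edges H) y)     ≡⟨ sym (*-assoc (fromℕ k ^ r) _ _) ⟩
      Φ y                                                     ≤⟨ Φ≤Ψ n (∣p∣≤n Sub.⊤) (λ _ i∉⊤ → ⊥-elim (i∉⊤ ∈⊤)) y≥0 ⟩
      fromℕ (fall k r) * sumF y ^ r                           ≡⟨ cong (λ s → fromℕ (fall k r) * s ^ r) ∑y≡1 ⟩
      fromℕ (fall k r) * 1ℚ ^ r                               ≡⟨ cong (fromℕ (fall k r) *_) (1^n≡1 r) ⟩
      fromℕ (fall k r) * 1ℚ                                   ≡⟨ *-identityʳ (fromℕ (fall k r)) ⟩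
      fromℕ (fall k r)                                        ∎
      where open ≤-Reasoning

open import Defs
open import Data.Nat using (ℕ; suc; _≤_; _^_)
open import Data.Fin using (Fin)
open import Data.Rational using (ℚ; ∣_∣; 1ℚ) renaming (_≤_ to _≤ℚ_; _*_ to _*ℚ_)
open import Relation.Binary.PropositionalEquality using (_≡_)
open import Data.Rational.Properties using (≤-trans; 0≤∣p∣)

corollary3p6 : (k r : ℕ) → 2 ≤ r → r ≤ k →
    ∀ n (H : RGraph r n) → KFree (suc k) r H →
    (x : Fin n → ℚ) → sumF (λ i → ∣ x i ∣) ≡ 1ℚ →
    fromℕ (k ^ r) *ℚ lagPoly H x ≤ℚ fromℕ (fall k r)
corollary3p6 k r _ _ n H free x ∑∣x∣≡1 =
  ≤-trans (*-monoˡ-≤-0≤ (fromℕ-nonNeg (k ^ r)) (lagPoly-≤-∣∣ H x))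
          (lagrangian-bound k H free (λ i → 0≤∣p∣ (x i)) ∑∣x∣≡1)
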